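{- The following eight mesh patterns $(12,R)$ are pairwise equidistributed, where $R$ ranges over: $\{(0,2),(1,2),(2,2),(1,1),(0,0)\}$, $\{(0,2),(2,2),(0,1),(1,1),(0,0)\}$, $\{(2,2),(1,1),(2,1),(0,0),(2,0)\}$, $\{(2,2),(1,1),(0,0),(1,0),(2,0)\}$, $\{(0,2),(1,2),(0,1),(2,1),(0,0)\}$, $\{(0,2),(1,2),(2,2),(0,1),(1,0)\}$, $\{(2,2),(0,1),(2,1),(1,0),(2,0)\}$, $\{(1,2),(2,1),(0,0),(1,0),(2,0)\}$.
   Context: For $R\subseteq\{0,1,2\}^2$ and $\pi=\pi_1\cdots\pi_n\in S_n$, an occurrence of the mesh pattern $(12,R)$ in $\pi$ is a pair of positions $i_1<i_2$ with $\pi_{i_1}<\pi_{i_2}$ such that, setting $x_0=0,x_1=i_1,x_2=i_2,x_3=n+1$ and $y_0=0,y_1=\pi_{i_1},y_2=\pi_{i_2},y_3=n+1$, for every $(a,b)\in R$ there is no index $k$ with $x_a<k<x_{a+1}$ and $y_b<\pi_k<y_{b+1}$. $s_{n,k}(p)$ is the number of $\pi\in S_n$ with exactly $k$ occurrences of $p$; $p_1,p_2$ are equidistributed if $s_{n,k}(p_1)=s_{n,k}(p_2)$ for all $n,k\ge 0$. -}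

module Defs where

open import Data.Nat using (ℕ; zero; suc; _+_; _<ᵇ_; _≡ᵇ_)
open import Data.Bool using (Bool; true; false; _∧_; _∨_; not; if_then_else_)
open import Data.List using (List; []; _∷_; map; concatMap; filter; length; upTo)
open import Data.Bool.ListAction using (all; any)
open import Data.Nat.ListAction using (sum)
open import Data.Product using (_×_; _,_)
open import Data.Fin using (Fin)
open import Data.Vec using (Vec; lookup) renaming ([] to []ᵛ; _∷_ to _∷ᵛ_)
open import Relation.Binary.PropositionalEquality using (_≡_)
open import Relation.Nullary.Decidable using (does)
open import Data.Bool.Properties using (_≟_)

range : ℕ → List ℕ
range n = map suc (upTo n)

words : ℕ → List ℕ → List (List ℕ)
words zero    vals = [] ∷ []
words (suc l) vals = concatMap (λ v → map (v ∷_) (words l vals)) vals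

distinct : List ℕ → Bool
distinct []       = true
distinct (x ∷ xs) = not (any (λ y → x ≡ᵇ y) xs) ∧ distinct xs

-- S_n: permutations of [1..n] in one-line notation π₁ ⋯ πₙ
perms : ℕ → List (List ℕ)
perms n = filter (λ w → distinct w ≟ true) (words n (range n))

-- π_i (1-indexed); 0 outside 1..length
at : List ℕ → ℕ → ℕ
at []       _             = 0
at (x ∷ xs) zero          = 0
at (x ∷ xs) (suc zero)    = x
at (x ∷ xs) (suc (suc i)) = at xs (suc i)

-- a mesh pattern (12,R), R given as a list of boxes (a,b) ∈ {0,1,2}²
Mesh : Set
Mesh = List (ℕ × ℕ)

sel : ℕ → ℕ → ℕ → ℕ → ℕ → ℕ
sel z0 z1 z2 z3 0 = z0
sel z0 z1 z2 z3 1 = z1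
sel z0 z1 z2 z3 2 = z2
sel z0 z1 z2 z3 _ = z3

isOcc : Mesh → ℕ → List ℕ → ℕ → ℕ → Bool
isOcc R n π i1 i2 =
  (i1 <ᵇ i2) ∧ (at π i1 <ᵇ at π i2) ∧ all boxEmpty R
  where
    x : ℕ → ℕ
    x = sel 0 i1 i2 (suc n)
    y : ℕ → ℕ
    y = sel 0 (at π i1) (at π i2) (suc n)
    boxEmpty : ℕ × ℕ → Bool
    boxEmpty (a , b) =
      not (any (λ k → (x a <ᵇ k) ∧ (k <ᵇ x (suc a))
                      ∧ (y b <ᵇ at π k) ∧ (at π k <ᵇ y (suc b)))
               (range n))

occ : Mesh → ℕ → List ℕ → ℕ
occ R n π =
  sum (map (λ i1 → length (filter (λ i2 → isOcc R n π i1 i2 ≟ true) (range n)))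
           (range n))

s : ℕ → ℕ → Mesh → ℕ
s n k R = length (filter (λ π → (occ R n π ≡ᵇ k) ≟ true) (perms n))

Equidistributed : Mesh → Mesh → Set
Equidistributed R₁ R₂ = ∀ n k → s n k R₁ ≡ s n k R₂

R8 : Vec Mesh 8
R8 = ((0 , 2) ∷ (1 , 2) ∷ (2 , 2) ∷ (1 , 1) ∷ (0 , 0) ∷ [])
  ∷ᵛ ((0 , 2) ∷ (2 , 2) ∷ (0 , 1) ∷ (1 , 1) ∷ (0 , 0) ∷ [])
  ∷ᵛ ((2 , 2) ∷ (1 , 1) ∷ (2 , 1) ∷ (0 , 0) ∷ (2 , 0) ∷ [])
  ∷ᵛ ((2 , 2) ∷ (1 , 1) ∷ (0 , 0) ∷ (1 , 0) ∷ (2 , 0) ∷ [])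
  ∷ᵛ ((0 , 2) ∷ (1 , 2) ∷ (0 , 1) ∷ (2 , 1) ∷ (0 , 0) ∷ [])
  ∷ᵛ ((0 , 2) ∷ (1 , 2) ∷ (2 , 2) ∷ (0 , 1) ∷ (1 , 0) ∷ [])
  ∷ᵛ ((2 , 2) ∷ (0 , 1) ∷ (2 , 1) ∷ (1 , 0) ∷ (2 , 0) ∷ [])
  ∷ᵛ ((1 , 2) ∷ (2 , 1) ∷ (0 , 0) ∷ (1 , 0) ∷ (2 , 0) ∷ [])
  ∷ᵛ []ᵛ

{-# OPTIONS --safe #-}

-- Each link between two of the shadings comes from an involution of Sₙ together with a
-- bijection of position pairs carrying the occurrences of one pattern in π onto those of
-- the other in the image of π, so occurrence counts, and hence distributions, agree.
-- Taking inverses reflects the mesh diagram in its diagonal and reverse-complement turns it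
-- by a half-turn. When the whole left column is shaded, an occurrence (i₁, i₂) has i₁ = 1,
-- since otherwise the point (1, π₁) lies in a shaded box of that column; the involution
-- π₁π₂⋯πₙ ↦ π₁πₙ⋯π₂ then exchanges the middle and the right column. Counting the shadings
-- of R8 from 0, inverses link 0–2, 4–7 and 6–5, reverse-complement links 2–1, 0–3 and 4–6,
-- and the tail reversal links 1–4.

module Submission where

open import Defs
open import Data.Bool using (Bool; true; false; _∧_; not; T)
open import Data.Bool.ListAction using (and; or; any; all)
open import Data.Bool.Properties using (_≟_; T-≡; T-∧; T-not-≡; ∧-assoc; ∧-comm)
open import Data.Empty using (⊥; ⊥-elim)
open import Data.Fin using (Fin; zero; suc; #_)
open import Data.List
  using (List; []; _∷_; _++_; map; filter; length; applyUpTo; cartesianProductWith; concatMap)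
open import Data.List.Membership.Propositional using (_∈_)
open import Data.List.Membership.Propositional.Properties
  using (∈-map⁺; ∈-applyUpTo⁺; ∈-applyUpTo⁻; ∈-cartesianProductWith⁺; ∈-cartesianProductWith⁻;
         ∈-∃++; ∈-filter⁺; ∈-filter⁻)
open import Data.List.Properties
  using (map-∘; map-cong; map-cong-local; length-map; map-applyUpTo; length-applyUpTo;
         ∷-injective; ++-identityʳ; length-++)
open import Data.List.Relation.Binary.Permutation.Propositional
  using (_↭_; ↭-refl; ↭-sym; ↭-trans; ↭-reflexive; prep; ↭⇒↭ₛ)
open import Data.List.Relation.Binary.Permutation.Propositional.Properties
  using (shift; ∈-resp-↭; ↭-length; map⁺; Any-resp-↭)
import Data.List.Relation.Binary.Permutation.Setoid.Properties as PermSetoid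
open import Data.List.Relation.Binary.Subset.Propositional using (_⊆_)
open import Data.List.Relation.Unary.All as All using (All; []; _∷_)
open import Data.List.Relation.Unary.All.Properties using (All¬⇒¬Any; all⁺; all-anti-mono)
open import Data.List.Relation.Unary.Any as Any using (here; there)
open import Data.List.Relation.Unary.Any.Properties using (any⁺; any⁻)
open import Data.List.Relation.Unary.Unique.Propositional using (Unique; []; _∷_)
import Data.List.Relation.Unary.Unique.Propositional.Properties as Unique
open import Data.Nat using (ℕ; zero; suc; _+_; _∸_; _≤_; _<_; z≤n; s≤s; z<s; s<s; _≡ᵇ_; _<ᵇ_)
open import Data.Nat.ListAction using (sum)
open import Data.Nat.ListAction.Properties using (sum-↭)
open import Data.Nat.Properties
  using (_≤?_; ≤-refl; ≤-trans; <-≤-trans; <⇒≤; <⇒≢; <-cmp; n≮0; suc-injective; +-suc;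
         +-commutativeSemigroup; m≢1+m+n; ≡⇒≡ᵇ; ≡ᵇ⇒≡; <⇒<ᵇ; <ᵇ⇒<; n∸n≡0; m+n∸n≡m; m∸n≤m;
         m∸[m∸n]≡n; +-∸-assoc; m<n⇒0<n∸m; ∸-cancelʳ-<; ∸-monoʳ-<; m≤n⇒m≤1+n)
  renaming (_≟_ to _≟ℕ_)
open import Data.Product using (_×_; _,_; proj₁; proj₂; ∃-syntax; swap)
open import Data.Product.Properties using (≡-dec)
open import Data.Vec using (lookup)
open import Function using (_∘_; id; Equivalence)
open import Relation.Binary.Definitions using (tri<; tri≈; tri>)
open import Relation.Binary.PropositionalEquality
open import Relation.Nullary using (¬_; Dec; yes; no; _×-dec_)
open import Relation.Nullary.Decidable using (True; toWitness)

open import Data.List.Relation.Binary.Subset.DecPropositional (≡-dec _≟ℕ_ _≟ℕ_) using (_⊆?_)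

open Equivalence using (to; from)

range≡applyUpTo : ∀ n → range n ≡ applyUpTo suc n
range≡applyUpTo n = map-applyUpTo id suc n

∈-range⁺ : ∀ {n i} → i < n → suc i ∈ range n
∈-range⁺ {n} i<n rewrite range≡applyUpTo n = ∈-applyUpTo⁺ suc i<n

∈-range⁻ : ∀ {n k} → k ∈ range n → ∃[ i ] k ≡ suc i × i < n
∈-range⁻ {n} k∈ rewrite range≡applyUpTo n with i , i<n , refl ← ∈-applyUpTo⁻ suc k∈ = i , refl , i<n

∈-range⇒0< : ∀ {n k} → k ∈ range n → 0 < k
∈-range⇒0< k∈ with _ , refl , _ ← ∈-range⁻ k∈ = z<s

∈-range⇒≤ : ∀ {n k} → k ∈ range n → k ≤ n
∈-range⇒≤ k∈ with _ , refl , i<n ← ∈-range⁻ k∈ = i<n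

1∈range : ∀ {n k} → k ∈ range n → 1 ∈ range n
1∈range k∈ with _ , refl , i<n ← ∈-range⁻ k∈ = ∈-range⁺ (<-≤-trans z<s i<n)

∈-range⇒≤1+ : ∀ {n k} → k ∈ range n → k ≤ suc n
∈-range⇒≤1+ k∈ = m≤n⇒m≤1+n (∈-range⇒≤ k∈)

length-range : ∀ n → length (range n) ≡ n
length-range n rewrite range≡applyUpTo n = length-applyUpTo suc n

range-unique : ∀ n → Unique (range n)
range-unique n = Unique.map⁺ suc-injective (Unique.upTo⁺ n)

unique-⊆⇒↭++ : ∀ {A : Set} {xs ys : List A} → Unique xs → xs ⊆ ys → ∃[ zs ] ys ↭ xs ++ zs
unique-⊆⇒↭++ {xs = []} {ys} _ _ = ys , ↭-refl
unique-⊆⇒↭++ {xs = x ∷ xs} (x∉xs ∷ xs!) xs⊆ys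
  with as , bs , refl ← ∈-∃++ (xs⊆ys (here refl)) =
  let zs , p = unique-⊆⇒↭++ xs! xs⊆as++bs in zs , ↭-trans (shift x as bs) (prep x p)
  where
    xs⊆as++bs : xs ⊆ as ++ bs
    xs⊆as++bs {v} v∈xs with ∈-resp-↭ (shift x as bs) (xs⊆ys (there v∈xs))
    ... | here refl = ⊥-elim (All.lookup x∉xs v∈xs refl)
    ... | there v∈ = v∈

unique-⊆-length⇒↭ : ∀ {A : Set} {xs ys : List A} → Unique xs → xs ⊆ ys → length xs ≡ length ys → xs ↭ ys
unique-⊆-length⇒↭ {xs = xs} xs! xs⊆ys |xs|≡|ys| with unique-⊆⇒↭++ xs! xs⊆ys
... | [] , p = ↭-sym (↭-trans p (↭-reflexive (++-identityʳ xs)))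
... | z ∷ zs , p = ⊥-elim (m≢1+m+n (length xs)
  (trans |xs|≡|ys| (trans (↭-length p) (trans (length-++ xs) (+-suc (length xs) (length zs))))))

concatMap-map≡cartesianProductWith : ∀ {A B C : Set} (f : A → B → C) xs ys →
  concatMap (λ x → map (f x) ys) xs ≡ cartesianProductWith f xs ys
concatMap-map≡cartesianProductWith f []       ys = refl
concatMap-map≡cartesianProductWith f (x ∷ xs) ys =
  cong (map (f x) ys ++_) (concatMap-map≡cartesianProductWith f xs ys)

words-suc : ∀ l vals → words (suc l) vals ≡ cartesianProductWith _∷_ vals (words l vals)
words-suc l vals = concatMap-map≡cartesianProductWith _∷_ vals (words l vals)

∈-words⁺ : ∀ {l vals w} → length w ≡ l → All (_∈ vals) w → w ∈ words l vals
∈-words⁺ {zero}  {w = []}    refl []            = here refl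
∈-words⁺ {suc l} {vals} {x ∷ xs} refl (x∈ ∷ xs⊆) rewrite words-suc l vals =
  ∈-cartesianProductWith⁺ _∷_ x∈ (∈-words⁺ refl xs⊆)

∈-words⁻ : ∀ {l vals w} → w ∈ words l vals → length w ≡ l × All (_∈ vals) w
∈-words⁻ {zero}  (here refl) = refl , []
∈-words⁻ {suc l} {vals} w∈ rewrite words-suc l vals
  with x , xs , x∈ , xs∈ , refl ← ∈-cartesianProductWith⁻ _∷_ vals (words l vals) w∈
  with |xs| , xs⊆ ← ∈-words⁻ xs∈ = cong suc |xs| , x∈ ∷ xs⊆

words-unique : ∀ l {vals} → Unique vals → Unique (words l vals)
words-unique zero    _     = [] ∷ []
words-unique (suc l) {vals} vals! rewrite words-suc l vals =
  Unique.cartesianProductWith⁺ _∷_ ∷-injective vals! (words-unique l vals!)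

T-not⇒¬T : ∀ {b} → T (not b) → ¬ T b
T-not⇒¬T {false} _ ()

¬T⇒T-not : ∀ {b} → ¬ T b → T (not b)
¬T⇒T-not {false} _  = _
¬T⇒T-not {true}  ¬t = ¬t _

T-ext : ∀ {a b} → (T a → T b) → (T b → T a) → a ≡ b
T-ext {false} {false} _ _ = refl
T-ext {false} {true}  _ g = ⊥-elim (g _)
T-ext {true}  {false} f _ = ⊥-elim (f _)
T-ext {true}  {true}  _ _ = refl

distinct⇒Unique : ∀ w → T (distinct w) → Unique w
distinct⇒Unique []       _ = []
distinct⇒Unique (x ∷ xs) d with fresh , rest ← to T-∧ d =
  All.tabulate (λ y∈xs x≡y → T-not⇒¬T fresh (any⁺ _ (Any.map (≡⇒≡ᵇ x _ ∘ trans x≡y) y∈xs)))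
    ∷ distinct⇒Unique xs rest

Unique⇒distinct : ∀ {w} → Unique w → T (distinct w)
Unique⇒distinct []             = _
Unique⇒distinct {x ∷ xs} (x∉xs ∷ xs!) = from T-∧ (¬T⇒T-not x∉any , Unique⇒distinct xs!)
  where
    x∉any : ¬ T (any (x ≡ᵇ_) xs)
    x∉any t = All¬⇒¬Any x∉xs (Any.map (≡ᵇ⇒≡ x _) (any⁻ _ xs t))

Unique-resp-↭ : ∀ {A : Set} {xs ys : List A} → xs ↭ ys → Unique xs → Unique ys
Unique-resp-↭ p = PermSetoid.Unique-resp-↭ (setoid _) (↭⇒↭ₛ p)

∈-perms⁻ : ∀ {n π} → π ∈ perms n → π ↭ range n
∈-perms⁻ {n} {π} π∈
  with w∈ , d ← ∈-filter⁻ (λ w → distinct w ≟ true) {xs = words n (range n)} π∈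
  with |π| , π⊆ ← ∈-words⁻ w∈ =
  unique-⊆-length⇒↭ (distinct⇒Unique π (from T-≡ d)) (All.lookup π⊆) (trans |π| (sym (length-range n)))

∈-perms⁺ : ∀ {n π} → π ↭ range n → π ∈ perms n
∈-perms⁺ {n} p = ∈-filter⁺ (λ w → distinct w ≟ true)
  (∈-words⁺ (trans (↭-length p) (length-range n)) (All.tabulate (∈-resp-↭ p)))
  (to T-≡ (Unique⇒distinct (Unique-resp-↭ (↭-sym p) (range-unique n))))

perms-unique : ∀ n → Unique (perms n)
perms-unique n = Unique.filter⁺ (λ w → distinct w ≟ true) (words-unique n (range-unique n))

surjective⇒↭ : ∀ {n} (g : ℕ → ℕ) → (∀ {j} → j ∈ range n → ∃[ k ] k ∈ range n × g k ≡ j) →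
  map g (range n) ↭ range n
surjective⇒↭ {n} g surj =
  ↭-sym (unique-⊆-length⇒↭ (range-unique n) range⊆image (sym (length-map g (range n))))
  where
    range⊆image : range n ⊆ map g (range n)
    range⊆image j∈ with k , k∈ , refl ← surj j∈ = ∈-map⁺ g k∈

at-cons : ∀ {x xs k n} → k ∈ range n → at (x ∷ xs) (suc k) ≡ at xs k
at-cons k∈ with _ , refl , _ ← ∈-range⁻ k∈ = refl

at-applyUpTo : ∀ (f : ℕ → ℕ) {n i} → i < n → at (applyUpTo f n) (suc i) ≡ f i
at-applyUpTo f {suc n} {zero}  _         = refl
at-applyUpTo f {suc n} {suc i} (s≤s i<n) = at-applyUpTo (f ∘ suc) i<n

at-map-range : ∀ (g : ℕ → ℕ) {n k} → k ∈ range n → at (map g (range n)) k ≡ g k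
at-map-range g {n} k∈ with i , refl , i<n ← ∈-range⁻ k∈ =
  begin
    at (map g (range n)) (suc i)         ≡⟨ cong (λ xs → at (map g xs) (suc i)) (range≡applyUpTo n) ⟩
    at (map g (applyUpTo suc n)) (suc i) ≡⟨ cong (λ xs → at xs (suc i)) (map-applyUpTo suc g n) ⟩
    at (applyUpTo (g ∘ suc) n) (suc i)   ≡⟨ at-applyUpTo (g ∘ suc) i<n ⟩
    g (suc i)                            ∎
  where open ≡-Reasoning

map-at-range : ∀ π → map (at π) (range (length π)) ≡ π
map-at-range π = trans (cong (map (at π)) (range≡applyUpTo (length π)))
                       (trans (map-applyUpTo suc (at π) (length π)) (applyUpTo-at π))
  where
    applyUpTo-at : ∀ π → applyUpTo (at π ∘ suc) (length π) ≡ π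
    applyUpTo-at []       = refl
    applyUpTo-at (x ∷ xs) = cong (x ∷_) (applyUpTo-at xs)

at-∈ : ∀ π {k} → k ∈ range (length π) → at π k ∈ π
at-∈ π k∈ with i , refl , i<n ← ∈-range⁻ k∈ = at-suc-∈ π i<n
  where
    at-suc-∈ : ∀ π {i} → i < length π → at π (suc i) ∈ π
    at-suc-∈ (x ∷ xs) {zero}  _         = here refl
    at-suc-∈ (x ∷ xs) {suc i} (s≤s i<n) = there (at-suc-∈ xs i<n)

pos : List ℕ → ℕ → ℕ
pos []       v = 0
pos (x ∷ xs) v with x ≟ℕ v
... | yes _ = 1
... | no  _ = suc (pos xs v)

pos-∈ : ∀ π {v} → v ∈ π → pos π v ∈ range (length π)
pos-∈ (x ∷ xs) {v} v∈ with x ≟ℕ v | v∈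
... | yes _   | _          = ∈-range⁺ z<s
... | no  x≢v | here refl  = ⊥-elim (x≢v refl)
... | no  _   | there v∈xs with i , eq , i<n ← ∈-range⁻ (pos-∈ xs v∈xs) rewrite eq = ∈-range⁺ (s<s i<n)

at-pos : ∀ π {v} → v ∈ π → at π (pos π v) ≡ v
at-pos (x ∷ xs) {v} v∈ with x ≟ℕ v | v∈
... | yes x≡v | _          = x≡v
... | no  x≢v | here refl  = ⊥-elim (x≢v refl)
... | no  _   | there v∈xs = trans (at-cons (pos-∈ xs v∈xs)) (at-pos xs v∈xs)

pos-at : ∀ {π k} → Unique π → k ∈ range (length π) → pos π (at π k) ≡ k
pos-at π! k∈ with i , refl , i<n ← ∈-range⁻ k∈ = pos-at-suc π! i<n
  where
    pos-at-suc : ∀ {π i} → Unique π → i < length π → pos π (at π (suc i)) ≡ suc i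
    pos-at-suc {x ∷ xs} {zero} _ _ with x ≟ℕ x
    ... | yes _   = refl
    ... | no  x≢x = ⊥-elim (x≢x refl)
    pos-at-suc {x ∷ xs} {suc i} (x∉xs ∷ xs!) (s≤s i<n) with x ≟ℕ at xs (suc i)
    ... | yes x≡ = ⊥-elim (All.lookup x∉xs (at-∈ xs (∈-range⁺ i<n)) x≡)
    ... | no  _  = cong suc (pos-at-suc xs! i<n)

module Perm {n π} (π↭ : π ↭ range n) where

  length≡ : length π ≡ n
  length≡ = trans (↭-length π↭) (length-range n)

  unique : Unique π
  unique = Unique-resp-↭ (↭-sym π↭) (range-unique n)

  at∈ : ∀ {k} → k ∈ range n → at π k ∈ range n
  at∈ k∈ = ∈-resp-↭ π↭ (at-∈ π (subst (λ m → _ ∈ range m) (sym length≡) k∈))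

  pos∈ : ∀ {v} → v ∈ range n → pos π v ∈ range n
  pos∈ v∈ = subst (λ m → _ ∈ range m) length≡ (pos-∈ π (∈-resp-↭ (↭-sym π↭) v∈))

  at∘pos : ∀ {v} → v ∈ range n → at π (pos π v) ≡ v
  at∘pos v∈ = at-pos π (∈-resp-↭ (↭-sym π↭) v∈)

  pos∘at : ∀ {k} → k ∈ range n → pos π (at π k) ≡ k
  pos∘at k∈ = pos-at unique (subst (λ m → _ ∈ range m) (sym length≡) k∈)

  at-injective : ∀ {i j} → i ∈ range n → j ∈ range n → at π i ≡ at π j → i ≡ j
  at-injective i∈ j∈ eq = trans (sym (pos∘at i∈)) (trans (cong (pos π) eq) (pos∘at j∈))

  map-at : map (at π) (range n) ≡ π
  map-at = subst (λ m → map (at π) (range m) ≡ π) length≡ (map-at-range π)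

  at-↭ : map (at π) (range n) ↭ range n
  at-↭ = subst (_↭ range n) (sym map-at) π↭

  ext : ∀ {G : ℕ → ℕ} → (∀ {k} → k ∈ range n → G k ≡ at π k) → map G (range n) ≡ π
  ext G≗at = trans (map-cong-local (All.tabulate G≗at)) map-at

-- Counting

𝟙 : Bool → ℕ
𝟙 true  = 1
𝟙 false = 0

length-filter≡sum-𝟙 : ∀ {A : Set} (b : A → Bool) xs →
  length (filter (λ x → b x ≟ true) xs) ≡ sum (map (𝟙 ∘ b) xs)
length-filter≡sum-𝟙 b []       = refl
length-filter≡sum-𝟙 b (x ∷ xs) with b x
... | true  = cong suc (length-filter≡sum-𝟙 b xs)
... | false = length-filter≡sum-𝟙 b xs

equidistributed-by-involution : ∀ R₁ R₂ (f : ℕ → List ℕ → List ℕ) →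
  (∀ {n π} → π ↭ range n → f n π ↭ range n) →
  (∀ {n π} → π ↭ range n → f n (f n π) ≡ π) →
  (∀ {n π} → π ↭ range n → occ R₂ n (f n π) ≡ occ R₁ n π) →
  Equidistributed R₁ R₂
equidistributed-by-involution R₁ R₂ f f-perm f-involutive f-occ n k =
  begin
    s n k R₁                                ≡⟨ length-filter≡sum-𝟙 (hits R₁) Sₙ ⟩
    sum (map (𝟙 ∘ hits R₁) Sₙ)              ≡⟨ cong sum (map-cong-local (All.tabulate (cong 𝟙 ∘ hits-f))) ⟩
    sum (map (𝟙 ∘ hits R₂ ∘ f n) Sₙ)        ≡⟨ cong sum (map-∘ Sₙ) ⟩
    sum (map (𝟙 ∘ hits R₂) (map (f n) Sₙ))  ≡⟨ sum-↭ (map⁺ (𝟙 ∘ hits R₂) (↭-sym Sₙ↭fSₙ)) ⟩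
    sum (map (𝟙 ∘ hits R₂) Sₙ)              ≡⟨ length-filter≡sum-𝟙 (hits R₂) Sₙ ⟨
    s n k R₂                                ∎
  where
    open ≡-Reasoning
    Sₙ : List (List ℕ)
    Sₙ = perms n
    hits : Mesh → List ℕ → Bool
    hits R π = occ R n π ≡ᵇ k
    hits-f : ∀ {π} → π ∈ Sₙ → hits R₁ π ≡ hits R₂ (f n π)
    hits-f π∈ = cong (_≡ᵇ k) (sym (f-occ (∈-perms⁻ {n} π∈)))
    Sₙ⊆fSₙ : Sₙ ⊆ map (f n) Sₙ
    Sₙ⊆fSₙ {π} π∈ = subst (_∈ map (f n) Sₙ) (f-involutive (∈-perms⁻ {n} π∈))
                      (∈-map⁺ (f n) (∈-perms⁺ (f-perm (∈-perms⁻ {n} π∈))))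
    Sₙ↭fSₙ : Sₙ ↭ map (f n) Sₙ
    Sₙ↭fSₙ = unique-⊆-length⇒↭ (perms-unique n) Sₙ⊆fSₙ (sym (length-map (f n) Sₙ))

sum-map-+ : ∀ {A : Set} (f g : A → ℕ) xs →
  sum (map (λ x → f x + g x) xs) ≡ sum (map f xs) + sum (map g xs)
sum-map-+ f g []       = refl
sum-map-+ f g (x ∷ xs) = trans (cong (f x + g x +_) (sum-map-+ f g xs)) (+-interchange (f x) (g x) _ _)
  where open import Algebra.Properties.CommutativeSemigroup +-commutativeSemigroup
          using () renaming (interchange to +-interchange)

sum-map-0 : ∀ {A : Set} (xs : List A) → sum (map (λ _ → 0) xs) ≡ 0
sum-map-0 []       = refl
sum-map-0 (_ ∷ xs) = sum-map-0 xs

sum-map-comm : ∀ {A B : Set} (F : A → B → ℕ) xs ys →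
  sum (map (λ x → sum (map (F x) ys)) xs) ≡ sum (map (λ y → sum (map (λ x → F x y) xs)) ys)
sum-map-comm F []       ys = sym (sum-map-0 ys)
sum-map-comm F (x ∷ xs) ys = trans (cong (sum (map (F x) ys) +_) (sum-map-comm F xs ys))
                                   (sym (sum-map-+ (F x) (λ y → sum (map (λ x → F x y) xs)) ys))

sum-map-reindex : ∀ {n} (g h : ℕ → ℕ) → map g (range n) ↭ range n →
  sum (map (h ∘ g) (range n)) ≡ sum (map h (range n))
sum-map-reindex {n} g h g↭ = trans (cong sum (map-∘ (range n))) (sum-↭ (map⁺ h g↭))

doubleSum : ℕ → (ℕ → ℕ → ℕ) → ℕ
doubleSum n F = sum (map (λ i → sum (map (F i) (range n))) (range n))

doubleSum-swap : ∀ n F → doubleSum n F ≡ doubleSum n (λ i j → F j i)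
doubleSum-swap n F = sum-map-comm F (range n) (range n)

doubleSum-reindex : ∀ {n} (g : ℕ → ℕ) F → map g (range n) ↭ range n →
  doubleSum n (λ i j → F (g i) (g j)) ≡ doubleSum n F
doubleSum-reindex {n} g F g↭ =
  trans (cong sum (map-cong (λ i → sum-map-reindex g (F (g i)) g↭) (range n)))
        (sum-map-reindex g (λ i → sum (map (F i) (range n))) g↭)

doubleSum-cong : ∀ {n F G} → (∀ {i j} → i ∈ range n → j ∈ range n → F i j ≡ G i j) →
  doubleSum n F ≡ doubleSum n G
doubleSum-cong F≗G = cong sum (map-cong-local (All.tabulate λ i∈ →
                       cong sum (map-cong-local (All.tabulate λ j∈ → F≗G i∈ j∈))))

occ≡doubleSum : ∀ R n π → occ R n π ≡ doubleSum n (λ i j → 𝟙 (isOcc R n π i j))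
occ≡doubleSum R n π = cong sum (map-cong (λ i → length-filter≡sum-𝟙 (isOcc R n π i) (range n)) (range n))

occ-reindex : ∀ {R₁ R₂ n π σ} (g : ℕ → ℕ) → map g (range n) ↭ range n →
  (∀ {i j} → i ∈ range n → j ∈ range n → isOcc R₂ n σ (g i) (g j) ≡ isOcc R₁ n π i j) →
  occ R₂ n σ ≡ occ R₁ n π
occ-reindex {R₁} {R₂} {n} {π} {σ} g g↭ occ-g =
  begin
    occ R₂ n σ                                           ≡⟨ occ≡doubleSum R₂ n σ ⟩
    doubleSum n (λ i j → 𝟙 (isOcc R₂ n σ i j))           ≡⟨ doubleSum-reindex g _ g↭ ⟨
    doubleSum n (λ i j → 𝟙 (isOcc R₂ n σ (g i) (g j)))   ≡⟨ doubleSum-cong (λ i∈ j∈ → cong 𝟙 (occ-g i∈ j∈)) ⟩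
    doubleSum n (λ i j → 𝟙 (isOcc R₁ n π i j))           ≡⟨ occ≡doubleSum R₁ n π ⟨
    occ R₁ n π                                           ∎
  where open ≡-Reasoning

occ-reindex-swap : ∀ {R₁ R₂ n π σ} (g : ℕ → ℕ) → map g (range n) ↭ range n →
  (∀ {i j} → i ∈ range n → j ∈ range n → isOcc R₂ n σ (g j) (g i) ≡ isOcc R₁ n π i j) →
  occ R₂ n σ ≡ occ R₁ n π
occ-reindex-swap {R₁} {R₂} {n} {π} {σ} g g↭ occ-g =
  begin
    occ R₂ n σ                                           ≡⟨ occ≡doubleSum R₂ n σ ⟩
    doubleSum n (λ i j → 𝟙 (isOcc R₂ n σ i j))           ≡⟨ doubleSum-reindex g _ g↭ ⟨
    doubleSum n (λ i j → 𝟙 (isOcc R₂ n σ (g i) (g j)))   ≡⟨ doubleSum-swap n _ ⟩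
    doubleSum n (λ i j → 𝟙 (isOcc R₂ n σ (g j) (g i)))   ≡⟨ doubleSum-cong (λ i∈ j∈ → cong 𝟙 (occ-g i∈ j∈)) ⟩
    doubleSum n (λ i j → 𝟙 (isOcc R₁ n π i j))           ≡⟨ occ≡doubleSum R₁ n π ⟨
    occ R₁ n π                                           ∎
  where open ≡-Reasoning

any-resp-↭ : ∀ {A : Set} (p : A → Bool) {xs ys} → xs ↭ ys → any p xs ≡ any p ys
any-resp-↭ p {xs} {ys} xs↭ys =
  T-ext (any⁺ p ∘ Any-resp-↭ xs↭ys ∘ any⁻ p xs) (any⁺ p ∘ Any-resp-↭ (↭-sym xs↭ys) ∘ any⁻ p ys)

any-reindex : ∀ {n} (g : ℕ → ℕ) (p : ℕ → Bool) → map g (range n) ↭ range n →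
  any (p ∘ g) (range n) ≡ any p (range n)
any-reindex {n} g p g↭ = trans (cong or (map-∘ (range n))) (any-resp-↭ p g↭)

all-resp-⊆⊇ : ∀ {A : Set} (p : A → Bool) {xs ys} → xs ⊆ ys → ys ⊆ xs → all p xs ≡ all p ys
all-resp-⊆⊇ p xs⊆ys ys⊆xs = T-ext (all-anti-mono p ys⊆xs) (all-anti-mono p xs⊆ys)

∧-swap-first : ∀ a b c → a ∧ b ∧ c ≡ b ∧ a ∧ c
∧-swap-first a b c = trans (sym (∧-assoc a b c)) (trans (cong (_∧ c) (∧-comm a b)) (∧-assoc b a c))

∧-swap-pairs : ∀ a b c d → a ∧ b ∧ c ∧ d ≡ c ∧ d ∧ a ∧ b
∧-swap-pairs a b c d =
  trans (sym (∧-assoc a b (c ∧ d))) (trans (∧-comm (a ∧ b) (c ∧ d)) (∧-assoc c d (a ∧ b)))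

∧-swap-within-pairs : ∀ a b c d → a ∧ b ∧ c ∧ d ≡ b ∧ a ∧ d ∧ c
∧-swap-within-pairs a b c d =
  trans (sym (∧-assoc a b (c ∧ d))) (trans (cong₂ _∧_ (∧-comm a b) (∧-comm c d)) (∧-assoc b a (d ∧ c)))

Box : Set
Box = ℕ × ℕ

SameBoxes : Mesh → Mesh → Set
SameBoxes R R′ = R ⊆ R′ × R′ ⊆ R

sameBoxes? : ∀ R R′ → Dec (SameBoxes R R′)
sameBoxes? R R′ = (R ⊆? R′) ×-dec (R′ ⊆? R)

pointIn : List ℕ → ℕ → ℕ → ℕ → ℕ → ℕ → Bool
pointIn π n X₁ X₂ Y₁ Y₂ = any (λ k → (X₁ <ᵇ k) ∧ (k <ᵇ X₂) ∧ (Y₁ <ᵇ at π k) ∧ (at π k <ᵇ Y₂)) (range n)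

-- Definitionally the box test inside isOcc, so that isOcc R n π i j unfolds to
-- (i <ᵇ j) ∧ (at π i <ᵇ at π j) ∧ all (boxEmpty n π i j) R.
boxEmpty : ℕ → List ℕ → ℕ → ℕ → Box → Bool
boxEmpty n π i j (a , b) = not (pointIn π n (x a) (x (suc a)) (y b) (y (suc b)))
  where
    x y : ℕ → ℕ
    x = sel 0 i j (suc n)
    y = sel 0 (at π i) (at π j) (suc n)

isOcc-transport : ∀ {R₁ R₂ n π σ i j i′ j′} (τ : Box → Box) → SameBoxes (map τ R₁) R₂ →
  (i′ <ᵇ j′) ∧ (at σ i′ <ᵇ at σ j′) ≡ (i <ᵇ j) ∧ (at π i <ᵇ at π j) →
  (∀ {x} → x ∈ R₁ → boxEmpty n σ i′ j′ (τ x) ≡ boxEmpty n π i j x) →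
  isOcc R₂ n σ i′ j′ ≡ isOcc R₁ n π i j
isOcc-transport {R₁} {R₂} {n} {π} {σ} {i} {j} {i′} {j′} τ (τR₁⊆R₂ , R₂⊆τR₁) order boxes =
  begin
    (i′ <ᵇ j′) ∧ (at σ i′ <ᵇ at σ j′) ∧ all (boxEmpty n σ i′ j′) R₂
      ≡⟨ ∧-assoc (i′ <ᵇ j′) _ _ ⟨
    ((i′ <ᵇ j′) ∧ (at σ i′ <ᵇ at σ j′)) ∧ all (boxEmpty n σ i′ j′) R₂
      ≡⟨ cong₂ _∧_ order (all-resp-⊆⊇ (boxEmpty n σ i′ j′) R₂⊆τR₁ τR₁⊆R₂) ⟩
    ((i <ᵇ j) ∧ (at π i <ᵇ at π j)) ∧ all (boxEmpty n σ i′ j′) (map τ R₁)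
      ≡⟨ cong (((i <ᵇ j) ∧ (at π i <ᵇ at π j)) ∧_) (cong and (sym (map-∘ R₁))) ⟩
    ((i <ᵇ j) ∧ (at π i <ᵇ at π j)) ∧ all (boxEmpty n σ i′ j′ ∘ τ) R₁
      ≡⟨ cong (((i <ᵇ j) ∧ (at π i <ᵇ at π j)) ∧_) (cong and (map-cong-local (All.tabulate boxes))) ⟩
    ((i <ᵇ j) ∧ (at π i <ᵇ at π j)) ∧ all (boxEmpty n π i j) R₁
      ≡⟨ ∧-assoc (i <ᵇ j) _ _ ⟩
    (i <ᵇ j) ∧ (at π i <ᵇ at π j) ∧ all (boxEmpty n π i j) R₁
      ∎
  where open ≡-Reasoning

T-pointIn : ∀ {π n X₁ X₂ Y₁ Y₂ k} → k ∈ range n → X₁ < k → k < X₂ → Y₁ < at π k → at π k < Y₂ →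
  T (pointIn π n X₁ X₂ Y₁ Y₂)
T-pointIn k∈ X₁<k k<X₂ Y₁<πk πk<Y₂ = any⁺ _ (Any.map (λ { refl →
  from T-∧ (<⇒<ᵇ X₁<k , from T-∧ (<⇒<ᵇ k<X₂ , from T-∧ (<⇒<ᵇ Y₁<πk , <⇒<ᵇ πk<Y₂))) }) k∈)

pointIn-leftColumn≡false : ∀ π n Y₁ Y₂ → pointIn π n 0 1 Y₁ Y₂ ≡ false
pointIn-leftColumn≡false π n Y₁ Y₂ = any-none (range n) λ { zero → refl ; (suc k) → refl }
  where
    any-none : ∀ {p : ℕ → Bool} xs → (∀ x → p x ≡ false) → any p xs ≡ false
    any-none []       _  = refl
    any-none (x ∷ xs) p≡ rewrite p≡ x = any-none xs p≡

leftColumn : Mesh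
leftColumn = (0 , 0) ∷ (0 , 1) ∷ (0 , 2) ∷ []

leftColumn⇒isOcc≡false : ∀ {R n π i j} → π ↭ range n → leftColumn ⊆ R →
  i ∈ range n → j ∈ range n → 2 ≤ i → isOcc R n π i j ≡ false
leftColumn⇒isOcc≡false {R} {n} {π} {i} {j} π↭ left⊆R i∈ j∈ 2≤i =
  to T-not-≡ (¬T⇒T-not λ occ →
    let i<j , rest = to T-∧ occ in notEmpty (<ᵇ⇒< i j i<j) (to T-∧ rest))
  where
    1∈ : 1 ∈ range n
    1∈ = 1∈range i∈
    π₁∈ : at π 1 ∈ range n
    π₁∈ = Perm.at∈ π↭ 1∈
    π₁≢ : ∀ {k} → k ∈ range n → 2 ≤ k → at π 1 ≢ at π k
    π₁≢ k∈ 2≤k eq = <⇒≢ 2≤k (Perm.at-injective π↭ 1∈ k∈ eq)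
    leftBoxOccupied : ∀ {b} → (0 , b) ∈ R → sel 0 (at π i) (at π j) (suc n) b < at π 1 →
      at π 1 < sel 0 (at π i) (at π j) (suc n) (suc b) → ¬ T (all (boxEmpty n π i j) R)
    leftBoxOccupied b∈ lo hi empty =
      T-not⇒¬T (All.lookup (all⁺ _ R empty) b∈) (T-pointIn {π} 1∈ z<s 2≤i lo hi)
    notEmpty : i < j → T (at π i <ᵇ at π j) × T (all (boxEmpty n π i j) R) → ⊥
    notEmpty i<j (_ , empty) with <-cmp (at π 1) (at π i) | <-cmp (at π 1) (at π j)
    ... | tri< π₁<πi _ _ | _ = leftBoxOccupied (left⊆R (here refl)) (∈-range⇒0< π₁∈) π₁<πi empty
    ... | tri≈ _ π₁≡πi _ | _ = π₁≢ i∈ 2≤i π₁≡πi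
    ... | tri> _ _ πi<π₁ | tri< π₁<πj _ _ = leftBoxOccupied (left⊆R (there (here refl))) πi<π₁ π₁<πj empty
    ... | tri> _ _ πi<π₁ | tri≈ _ π₁≡πj _ = π₁≢ j∈ (≤-trans 2≤i (<⇒≤ i<j)) π₁≡πj
    ... | tri> _ _ πi<π₁ | tri> _ _ πj<π₁ =
      leftBoxOccupied (left⊆R (there (there (here refl)))) πj<π₁ (s≤s (∈-range⇒≤ π₁∈)) empty

-- Inverse

inverse : ℕ → List ℕ → List ℕ
inverse n π = map (pos π) (range n)

module Inverse {n π} (π↭ : π ↭ range n) where

  σ : List ℕ
  σ = inverse n π

  at-σ : ∀ {k} → k ∈ range n → at σ k ≡ pos π k
  at-σ = at-map-range (pos π)

  at-σ∘at : ∀ {k} → k ∈ range n → at σ (at π k) ≡ k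
  at-σ∘at k∈ = trans (at-σ (Perm.at∈ π↭ k∈)) (Perm.pos∘at π↭ k∈)

  σ↭ : σ ↭ range n
  σ↭ = surjective⇒↭ (pos π) (λ j∈ → _ , Perm.at∈ π↭ j∈ , Perm.pos∘at π↭ j∈)

  involutive : inverse n σ ≡ π
  involutive = Perm.ext π↭ λ k∈ →
    trans (cong (pos σ) (sym (at-σ∘at k∈))) (Perm.pos∘at σ↭ (Perm.at∈ π↭ k∈))

  pointIn-σ : ∀ X₁ X₂ Y₁ Y₂ → pointIn σ n X₁ X₂ Y₁ Y₂ ≡ pointIn π n Y₁ Y₂ X₁ X₂
  pointIn-σ X₁ X₂ Y₁ Y₂ =
    trans (sym (any-reindex (at π) _ (Perm.at-↭ π↭)))
          (cong or (map-cong-local (All.tabulate λ {k} k∈ →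
             trans (cong (λ v → (X₁ <ᵇ at π k) ∧ (at π k <ᵇ X₂) ∧ (Y₁ <ᵇ v) ∧ (v <ᵇ Y₂)) (at-σ∘at k∈))
                   (∧-swap-pairs (X₁ <ᵇ at π k) (at π k <ᵇ X₂) (Y₁ <ᵇ k) (k <ᵇ Y₂)))))

  boxEmpty-σ : ∀ {i j} → i ∈ range n → j ∈ range n → ∀ x →
    boxEmpty n σ (at π i) (at π j) (swap x) ≡ boxEmpty n π i j x
  boxEmpty-σ {i} {j} i∈ j∈ (a , b) rewrite at-σ∘at i∈ | at-σ∘at j∈ =
    cong not (pointIn-σ (x b) (x (suc b)) (y a) (y (suc a)))
    where
      x y : ℕ → ℕ
      x = sel 0 (at π i) (at π j) (suc n)
      y = sel 0 i j (suc n)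

  isOcc-σ : ∀ {R₁ R₂} → SameBoxes (map swap R₁) R₂ → ∀ {i j} → i ∈ range n → j ∈ range n →
    isOcc R₂ n σ (at π i) (at π j) ≡ isOcc R₁ n π i j
  isOcc-σ {R₁} {R₂} same {i} {j} i∈ j∈ = isOcc-transport {R₁} {R₂} {n} {π} {σ} swap same
    (trans (cong₂ (λ u v → (at π i <ᵇ at π j) ∧ (u <ᵇ v)) (at-σ∘at i∈) (at-σ∘at j∈))
           (∧-comm (at π i <ᵇ at π j) (i <ᵇ j)))
    (λ {x} _ → boxEmpty-σ i∈ j∈ x)

  occ-σ : ∀ {R₁ R₂} → SameBoxes (map swap R₁) R₂ → occ R₂ n σ ≡ occ R₁ n π
  occ-σ {R₁} {R₂} same = occ-reindex {R₁} {R₂} {n} {π} {σ} (at π) (Perm.at-↭ π↭) (isOcc-σ same)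

inverse-equidistributed : ∀ R₁ R₂ → True (sameBoxes? (map swap R₁) R₂) → Equidistributed R₁ R₂
inverse-equidistributed R₁ R₂ same =
  equidistributed-by-involution R₁ R₂ inverse Inverse.σ↭ Inverse.involutive
    λ π↭ → Inverse.occ-σ π↭ (toWitness same)

-- Reverse-complement

∸-<ᵇ-flip : ∀ {N x y} → x ≤ N → y ≤ N → (N ∸ x <ᵇ N ∸ y) ≡ (y <ᵇ x)
∸-<ᵇ-flip {N} {x} {y} x≤N y≤N = T-ext
  (λ lt → <⇒<ᵇ (∸-cancelʳ-< {x} {y} {N} (<ᵇ⇒< (N ∸ x) (N ∸ y) lt)))
  (λ lt → <⇒<ᵇ (∸-monoʳ-< (<ᵇ⇒< y x lt) x≤N))

mirror : ℕ → ℕ → ℕ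
mirror n k = suc n ∸ k

mirror-involutive : ∀ {n k} → k ≤ suc n → mirror n (mirror n k) ≡ k
mirror-involutive = m∸[m∸n]≡n

mirror-∈ : ∀ {n k} → k ∈ range n → mirror n k ∈ range n
mirror-∈ {n} k∈ with i , refl , i<n ← ∈-range⁻ k∈ =
  subst (_∈ range n) (sym (+-∸-assoc 1 i<n)) (∈-range⁺ (∸-suc-< i<n))
  where
    ∸-suc-< : ∀ {m i} → i < m → m ∸ suc i < m
    ∸-suc-< {suc m} {i} _ = s≤s (m∸n≤m m i)

mirror-↭ : ∀ n → map (mirror n) (range n) ↭ range n
mirror-↭ n = surjective⇒↭ (mirror n) λ j∈ → _ , mirror-∈ j∈ , mirror-involutive (∈-range⇒≤1+ j∈)

halfTurn : Box → Box
halfTurn (a , b) = (2 ∸ a , 2 ∸ b)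

-- sel reads an index ≥ 3 as the degenerate strip at n + 1, which halfTurn does not respect.
InGrid : Box → Set
InGrid (a , b) = a ≤ 2 × b ≤ 2

inGrid? : ∀ x → Dec (InGrid x)
inGrid? (a , b) = (a ≤? 2) ×-dec (b ≤? 2)

sel≤ : ∀ {n u v} c → u ≤ suc n → v ≤ suc n → sel 0 u v (suc n) c ≤ suc n
sel≤ zero                _   _   = z≤n
sel≤ (suc zero)          u≤n _   = u≤n
sel≤ (suc (suc zero))    _   v≤n = v≤n
sel≤ (suc (suc (suc c))) _   _   = ≤-refl

sel-mirror : ∀ n {a} → a ≤ 2 → ∀ u v →
  sel 0 (mirror n v) (mirror n u) (suc n) (2 ∸ a) ≡ mirror n (sel 0 u v (suc n) (suc a)) ×
  sel 0 (mirror n v) (mirror n u) (suc n) (suc (2 ∸ a)) ≡ mirror n (sel 0 u v (suc n) a)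
sel-mirror n z≤n                 u v = refl , refl
sel-mirror n (s≤s z≤n)           u v = refl , refl
sel-mirror n (s≤s (s≤s z≤n))     u v = sym (n∸n≡0 n) , refl

reverseComplement : ℕ → List ℕ → List ℕ
reverseComplement n π = map (λ k → mirror n (at π (mirror n k))) (range n)

module ReverseComplement {n π} (π↭ : π ↭ range n) where

  σ : List ℕ
  σ = reverseComplement n π

  entry∘mirror : ∀ {k} → k ∈ range n → mirror n (at π (mirror n (mirror n k))) ≡ mirror n (at π k)
  entry∘mirror k∈ = cong (mirror n ∘ at π) (mirror-involutive (∈-range⇒≤1+ k∈))

  at-σ∘mirror : ∀ {k} → k ∈ range n → at σ (mirror n k) ≡ mirror n (at π k)
  at-σ∘mirror k∈ = trans (at-map-range _ (mirror-∈ k∈)) (entry∘mirror k∈)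

  σ↭ : σ ↭ range n
  σ↭ = surjective⇒↭ _ λ {j} j∈ →
    let k∈ = Perm.pos∈ π↭ (mirror-∈ j∈) in
    mirror n (pos π (mirror n j)) , mirror-∈ k∈ ,
    trans (entry∘mirror k∈)
          (trans (cong (mirror n) (Perm.at∘pos π↭ (mirror-∈ j∈))) (mirror-involutive (∈-range⇒≤1+ j∈)))

  involutive : reverseComplement n σ ≡ π
  involutive = Perm.ext π↭ λ k∈ →
    trans (cong (mirror n) (at-σ∘mirror k∈)) (mirror-involutive (∈-range⇒≤1+ (Perm.at∈ π↭ k∈)))

  pointIn-σ : ∀ {A₁ A₂ B₁ B₂} → A₁ ≤ suc n → A₂ ≤ suc n → B₁ ≤ suc n → B₂ ≤ suc n →
    pointIn σ n (mirror n A₂) (mirror n A₁) (mirror n B₂) (mirror n B₁) ≡ pointIn π n A₁ A₂ B₁ B₂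
  pointIn-σ {A₁} {A₂} {B₁} {B₂} A₁≤ A₂≤ B₁≤ B₂≤ =
    trans (sym (any-reindex (mirror n) _ (mirror-↭ n)))
          (cong or (map-cong-local (All.tabulate λ {k} k∈ →
            let πk≤ = ∈-range⇒≤1+ (Perm.at∈ π↭ k∈) in
            begin
              (mirror n A₂ <ᵇ mirror n k) ∧ (mirror n k <ᵇ mirror n A₁)
                ∧ (mirror n B₂ <ᵇ at σ (mirror n k)) ∧ (at σ (mirror n k) <ᵇ mirror n B₁)
                ≡⟨ cong (λ v → (mirror n A₂ <ᵇ mirror n k) ∧ (mirror n k <ᵇ mirror n A₁)
                                 ∧ (mirror n B₂ <ᵇ v) ∧ (v <ᵇ mirror n B₁)) (at-σ∘mirror k∈) ⟩
              (mirror n A₂ <ᵇ mirror n k) ∧ (mirror n k <ᵇ mirror n A₁)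
                ∧ (mirror n B₂ <ᵇ mirror n (at π k)) ∧ (mirror n (at π k) <ᵇ mirror n B₁)
                ≡⟨ cong₂ _∧_ (∸-<ᵇ-flip A₂≤ (∈-range⇒≤1+ k∈))
                     (cong₂ _∧_ (∸-<ᵇ-flip (∈-range⇒≤1+ k∈) A₁≤)
                       (cong₂ _∧_ (∸-<ᵇ-flip B₂≤ πk≤) (∸-<ᵇ-flip πk≤ B₁≤))) ⟩
              (k <ᵇ A₂) ∧ (A₁ <ᵇ k) ∧ (at π k <ᵇ B₂) ∧ (B₁ <ᵇ at π k)
                ≡⟨ ∧-swap-within-pairs (k <ᵇ A₂) (A₁ <ᵇ k) (at π k <ᵇ B₂) (B₁ <ᵇ at π k) ⟩
              (A₁ <ᵇ k) ∧ (k <ᵇ A₂) ∧ (B₁ <ᵇ at π k) ∧ (at π k <ᵇ B₂)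
                ∎)))
    where open ≡-Reasoning

  boxEmpty-σ : ∀ {i j} → i ∈ range n → j ∈ range n → ∀ {x} → InGrid x →
    boxEmpty n σ (mirror n j) (mirror n i) (halfTurn x) ≡ boxEmpty n π i j x
  boxEmpty-σ {i} {j} i∈ j∈ {a , b} (a≤2 , b≤2)
    rewrite at-σ∘mirror i∈ | at-σ∘mirror j∈
          | proj₁ (sel-mirror n a≤2 i j) | proj₂ (sel-mirror n a≤2 i j)
          | proj₁ (sel-mirror n b≤2 (at π i) (at π j)) | proj₂ (sel-mirror n b≤2 (at π i) (at π j)) =
    cong not (pointIn-σ (sel≤ a i≤ j≤) (sel≤ (suc a) i≤ j≤) (sel≤ b πi≤ πj≤) (sel≤ (suc b) πi≤ πj≤))
    where
      i≤ : i ≤ suc n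
      i≤ = ∈-range⇒≤1+ i∈
      j≤ : j ≤ suc n
      j≤ = ∈-range⇒≤1+ j∈
      πi≤ : at π i ≤ suc n
      πi≤ = ∈-range⇒≤1+ (Perm.at∈ π↭ i∈)
      πj≤ : at π j ≤ suc n
      πj≤ = ∈-range⇒≤1+ (Perm.at∈ π↭ j∈)

  isOcc-σ : ∀ {R₁ R₂} → SameBoxes (map halfTurn R₁) R₂ → All InGrid R₁ →
    ∀ {i j} → i ∈ range n → j ∈ range n → isOcc R₂ n σ (mirror n j) (mirror n i) ≡ isOcc R₁ n π i j
  isOcc-σ {R₁} {R₂} same grid {i} {j} i∈ j∈ = isOcc-transport {R₁} {R₂} {n} {π} {σ} halfTurn same
    (trans (cong₂ (λ u v → (mirror n j <ᵇ mirror n i) ∧ (u <ᵇ v)) (at-σ∘mirror j∈) (at-σ∘mirror i∈))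
           (cong₂ _∧_ (∸-<ᵇ-flip (∈-range⇒≤1+ j∈) (∈-range⇒≤1+ i∈))
                      (∸-<ᵇ-flip (∈-range⇒≤1+ (Perm.at∈ π↭ j∈)) (∈-range⇒≤1+ (Perm.at∈ π↭ i∈)))))
    (λ x∈ → boxEmpty-σ i∈ j∈ (All.lookup grid x∈))

  occ-σ : ∀ {R₁ R₂} → SameBoxes (map halfTurn R₁) R₂ → All InGrid R₁ → occ R₂ n σ ≡ occ R₁ n π
  occ-σ {R₁} {R₂} same grid =
    occ-reindex-swap {R₁} {R₂} {n} {π} {σ} (mirror n) (mirror-↭ n) (isOcc-σ same grid)

reverseComplement-equidistributed : ∀ R₁ R₂ →
  True (sameBoxes? (map halfTurn R₁) R₂) → True (All.all? inGrid? R₁) → Equidistributed R₁ R₂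
reverseComplement-equidistributed R₁ R₂ same grid =
  equidistributed-by-involution R₁ R₂ reverseComplement ReverseComplement.σ↭ ReverseComplement.involutive
    λ π↭ → ReverseComplement.occ-σ π↭ (toWitness same) (toWitness grid)

-- Reversing the tail

tailMirror : ℕ → ℕ → ℕ
tailMirror n (suc zero) = 1
tailMirror n k          = mirror (suc n) k

tailMirror-tail : ∀ {n i} → suc (suc i) ≤ n → tailMirror n (suc (suc i)) ≡ suc (suc (n ∸ suc (suc i)))
tailMirror-tail = +-∸-assoc 2

tailMirror-∈ : ∀ {n k} → k ∈ range n → tailMirror n k ∈ range n
tailMirror-∈ {n} {zero}        k∈ = ⊥-elim (n≮0 (∈-range⇒0< k∈))
tailMirror-∈ {n} {suc zero}    k∈ = k∈
tailMirror-∈ {n} {suc (suc i)} k∈ = subst (_∈ range n) (sym (tailMirror-tail k≤n))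
  (∈-range⁺ (subst (_≤ n) (tailMirror-tail k≤n) (m∸n≤m n i)))
  where
    k≤n : suc (suc i) ≤ n
    k≤n = ∈-range⇒≤ k∈

tailMirror-involutive : ∀ {n k} → k ∈ range n → tailMirror n (tailMirror n k) ≡ k
tailMirror-involutive {n} {zero}        k∈ = ⊥-elim (n≮0 (∈-range⇒0< k∈))
tailMirror-involutive {n} {suc zero}    _  = refl
tailMirror-involutive {n} {suc (suc i)} k∈ rewrite tailMirror-tail (∈-range⇒≤ k∈) =
  m∸[m∸n]≡n (∈-range⇒≤ k∈)

2≤tailMirror : ∀ {n k} → k ∈ range n → 2 ≤ k → 2 ≤ tailMirror n k
2≤tailMirror {n} {suc zero}    _  (s≤s ())
2≤tailMirror {n} {suc (suc i)} k∈ _ rewrite tailMirror-tail (∈-range⇒≤ k∈) = s≤s (s≤s z≤n)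

tailMirror-↭ : ∀ n → map (tailMirror n) (range n) ↭ range n
tailMirror-↭ n = surjective⇒↭ (tailMirror n) λ j∈ → _ , tailMirror-∈ j∈ , tailMirror-involutive j∈

swapColumns : Box → Box
swapColumns (1 , b) = (2 , b)
swapColumns (2 , b) = (1 , b)
swapColumns x       = x

leftColumn-image : ∀ {R₁ R₂} → SameBoxes (map swapColumns R₁) R₂ → leftColumn ⊆ R₁ → leftColumn ⊆ R₂
leftColumn-image {R₁} (image⊆R₂ , _) left⊆R₁ x∈ =
  image⊆R₂ (subst (_∈ map swapColumns R₁) (fixed x∈) (∈-map⁺ swapColumns (left⊆R₁ x∈)))
  where
    fixed : ∀ {x} → x ∈ leftColumn → swapColumns x ≡ x
    fixed (here refl)                 = refl
    fixed (there (here refl))         = refl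
    fixed (there (there (here refl))) = refl

reverseTail : ℕ → List ℕ → List ℕ
reverseTail n π = map (at π ∘ tailMirror n) (range n)

module ReverseTail {n π} (π↭ : π ↭ range n) where

  σ : List ℕ
  σ = reverseTail n π

  at-σ∘tailMirror : ∀ {k} → k ∈ range n → at σ (tailMirror n k) ≡ at π k
  at-σ∘tailMirror k∈ = trans (at-map-range _ (tailMirror-∈ k∈)) (cong (at π) (tailMirror-involutive k∈))

  σ↭ : σ ↭ range n
  σ↭ = surjective⇒↭ _ λ {j} j∈ → tailMirror n (pos π j) , tailMirror-∈ (Perm.pos∈ π↭ j∈) ,
    trans (cong (at π) (tailMirror-involutive (Perm.pos∈ π↭ j∈))) (Perm.at∘pos π↭ j∈)

  involutive : reverseTail n σ ≡ π
  involutive = Perm.ext π↭ (λ k∈ → at-σ∘tailMirror k∈)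

  pointIn-σ : ∀ {A₁ A₂ B₁ B₂} → 1 ≤ A₁ → A₁ ≤ suc n → A₂ ≤ suc n →
    pointIn σ n (mirror (suc n) A₂) (mirror (suc n) A₁) B₁ B₂ ≡ pointIn π n A₁ A₂ B₁ B₂
  pointIn-σ {A₁} {A₂} {B₁} {B₂} 1≤A₁ A₁≤ A₂≤ =
    trans (sym (any-reindex (tailMirror n) _ (tailMirror-↭ n)))
          (cong or (map-cong-local (All.tabulate λ {k} k∈ →
             trans (cong (λ v → (mirror (suc n) A₂ <ᵇ tailMirror n k)
                                   ∧ (tailMirror n k <ᵇ mirror (suc n) A₁) ∧ (B₁ <ᵇ v) ∧ (v <ᵇ B₂))
                         (at-σ∘tailMirror k∈))
                   (columns k∈))))
    where
      rows : ℕ → Bool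
      rows k = (B₁ <ᵇ at π k) ∧ (at π k <ᵇ B₂)
      columns : ∀ {k} → k ∈ range n →
        (mirror (suc n) A₂ <ᵇ tailMirror n k) ∧ (tailMirror n k <ᵇ mirror (suc n) A₁) ∧ rows k
          ≡ (A₁ <ᵇ k) ∧ (k <ᵇ A₂) ∧ rows k
      columns {zero} k∈ = ⊥-elim (n≮0 (∈-range⇒0< k∈))
      columns {suc zero} _ =
        trans (cong (_∧ (1 <ᵇ mirror (suc n) A₁) ∧ rows 1) (<ᵇ1 (m<n⇒0<n∸m (s≤s A₂≤))))
              (sym (cong (_∧ (1 <ᵇ A₂) ∧ rows 1) (<ᵇ1 1≤A₁)))
        where
          <ᵇ1 : ∀ {x} → 1 ≤ x → (x <ᵇ 1) ≡ false
          <ᵇ1 (s≤s z≤n) = refl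
      columns {k@(suc (suc _))} k∈ =
        let k≤ = m≤n⇒m≤1+n (∈-range⇒≤1+ k∈) in
        trans (cong₂ (λ u v → u ∧ v ∧ rows k)
                     (∸-<ᵇ-flip (m≤n⇒m≤1+n A₂≤) k≤) (∸-<ᵇ-flip k≤ (m≤n⇒m≤1+n A₁≤)))
              (∧-swap-first (k <ᵇ A₂) (A₁ <ᵇ k) (rows k))

  boxEmpty-σ-first : ∀ {j} → j ∈ range n → 2 ≤ j → ∀ {x} → InGrid x →
    boxEmpty n σ 1 (tailMirror n j) (swapColumns x) ≡ boxEmpty n π 1 j x
  boxEmpty-σ-first {suc zero} _ (s≤s ())
  boxEmpty-σ-first {j@(suc (suc _))} j∈ _ {a , b} (a≤2 , _)
    rewrite at-σ∘tailMirror (1∈range j∈) | at-σ∘tailMirror j∈ = cong not (column a≤2)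
    where
      y : ℕ → ℕ
      y = sel 0 (at π 1) (at π j) (suc n)
      j≤ : j ≤ suc n
      j≤ = ∈-range⇒≤1+ j∈
      column : ∀ {a} → a ≤ 2 → let (a′ , b′) = swapColumns (a , b) in
        pointIn σ n (sel 0 1 (mirror (suc n) j) (suc n) a′) (sel 0 1 (mirror (suc n) j) (suc n) (suc a′))
                    (y b′) (y (suc b′))
          ≡ pointIn π n (sel 0 1 j (suc n) a) (sel 0 1 j (suc n) (suc a)) (y b) (y (suc b))
      column z≤n             = trans (pointIn-leftColumn≡false σ n (y b) (y (suc b)))
                                     (sym (pointIn-leftColumn≡false π n (y b) (y (suc b))))
      column (s≤s z≤n)       = pointIn-σ {1} {j} {y b} {y (suc b)} ≤-refl (s≤s z≤n) j≤
      column (s≤s (s≤s z≤n)) =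
        subst (λ X → pointIn σ n X (mirror (suc n) j) (y b) (y (suc b))
                       ≡ pointIn π n j (suc n) (y b) (y (suc b)))
              (m+n∸n≡m 1 n) (pointIn-σ {j} {suc n} {y b} {y (suc b)} (s≤s z≤n) j≤ ≤-refl)

  isOcc-σ : ∀ {R₁ R₂} → SameBoxes (map swapColumns R₁) R₂ → All InGrid R₁ → leftColumn ⊆ R₁ →
    ∀ {i j} → i ∈ range n → j ∈ range n →
    isOcc R₂ n σ (tailMirror n i) (tailMirror n j) ≡ isOcc R₁ n π i j
  isOcc-σ {R₁} {R₂} same grid left⊆R₁ {i} {j} i∈ j∈ with i | j
  ... | zero        | _           = ⊥-elim (n≮0 (∈-range⇒0< i∈))
  ... | suc zero    | zero        = ⊥-elim (n≮0 (∈-range⇒0< j∈))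
  ... | suc zero    | suc zero    = refl
  ... | suc zero    | suc (suc _) = isOcc-transport {R₁} {R₂} {n} {π} {σ} swapColumns same
    (cong₂ _∧_ (to T-≡ (<⇒<ᵇ (2≤tailMirror j∈ (s≤s (s≤s z≤n)))))
               (cong₂ _<ᵇ_ (at-σ∘tailMirror (1∈range j∈)) (at-σ∘tailMirror j∈)))
    (λ x∈ → boxEmpty-σ-first j∈ (s≤s (s≤s z≤n)) (All.lookup grid x∈))
  ... | suc (suc _) | _           =
    trans (leftColumn⇒isOcc≡false σ↭ (leftColumn-image same left⊆R₁) (tailMirror-∈ i∈) (tailMirror-∈ j∈)
                                  (2≤tailMirror i∈ (s≤s (s≤s z≤n))))
          (sym (leftColumn⇒isOcc≡false π↭ left⊆R₁ i∈ j∈ (s≤s (s≤s z≤n))))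

  occ-σ : ∀ {R₁ R₂} → SameBoxes (map swapColumns R₁) R₂ → All InGrid R₁ → leftColumn ⊆ R₁ →
    occ R₂ n σ ≡ occ R₁ n π
  occ-σ {R₁} {R₂} same grid left⊆R₁ =
    occ-reindex {R₁} {R₂} {n} {π} {σ} (tailMirror n) (tailMirror-↭ n) (isOcc-σ same grid left⊆R₁)

reverseTail-equidistributed : ∀ R₁ R₂ → True (sameBoxes? (map swapColumns R₁) R₂) →
  True (All.all? inGrid? R₁) → True (leftColumn ⊆? R₁) → Equidistributed R₁ R₂
reverseTail-equidistributed R₁ R₂ same grid left =
  equidistributed-by-involution R₁ R₂ reverseTail ReverseTail.σ↭ ReverseTail.involutive
    λ π↭ → ReverseTail.occ-σ π↭ (toWitness same) (toWitness grid) (toWitness left)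

R0≈R2 : Equidistributed (lookup R8 (# 0)) (lookup R8 (# 2))
R0≈R2 = inverse-equidistributed (lookup R8 (# 0)) (lookup R8 (# 2)) _

R2≈R1 : Equidistributed (lookup R8 (# 2)) (lookup R8 (# 1))
R2≈R1 = reverseComplement-equidistributed (lookup R8 (# 2)) (lookup R8 (# 1)) _ _

R0≈R3 : Equidistributed (lookup R8 (# 0)) (lookup R8 (# 3))
R0≈R3 = reverseComplement-equidistributed (lookup R8 (# 0)) (lookup R8 (# 3)) _ _

R1≈R4 : Equidistributed (lookup R8 (# 1)) (lookup R8 (# 4))
R1≈R4 = reverseTail-equidistributed (lookup R8 (# 1)) (lookup R8 (# 4)) _ _ _

R4≈R7 : Equidistributed (lookup R8 (# 4)) (lookup R8 (# 7))
R4≈R7 = inverse-equidistributed (lookup R8 (# 4)) (lookup R8 (# 7)) _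

R4≈R6 : Equidistributed (lookup R8 (# 4)) (lookup R8 (# 6))
R4≈R6 = reverseComplement-equidistributed (lookup R8 (# 4)) (lookup R8 (# 6)) _ _

R6≈R5 : Equidistributed (lookup R8 (# 6)) (lookup R8 (# 5))
R6≈R5 = inverse-equidistributed (lookup R8 (# 6)) (lookup R8 (# 5)) _

R0≈R4 : Equidistributed (lookup R8 (# 0)) (lookup R8 (# 4))
R0≈R4 n k = trans (R0≈R2 n k) (trans (R2≈R1 n k) (R1≈R4 n k))

R0≈ : ∀ i → Equidistributed (lookup R8 (# 0)) (lookup R8 i)
R0≈ zero                                            n k = refl
R0≈ (suc zero)                                      n k = trans (R0≈R2 n k) (R2≈R1 n k)
R0≈ (suc (suc zero))                                    = R0≈R2
R0≈ (suc (suc (suc zero)))                              = R0≈R3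
R0≈ (suc (suc (suc (suc zero))))                        = R0≈R4
R0≈ (suc (suc (suc (suc (suc zero)))))              n k = trans (R0≈R4 n k) (trans (R4≈R6 n k) (R6≈R5 n k))
R0≈ (suc (suc (suc (suc (suc (suc zero))))))        n k = trans (R0≈R4 n k) (R4≈R6 n k)
R0≈ (suc (suc (suc (suc (suc (suc (suc zero))))))) n k = trans (R0≈R4 n k) (R4≈R7 n k)

theorem3p10 : (i j : Fin 8) → Equidistributed (lookup R8 i) (lookup R8 j)
theorem3p10 i j n k = trans (sym (R0≈ i n k)) (R0≈ j n k)
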